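{- Let $q$ be an odd prime and let $k,P,Q$ be integers such that $k^2+Pk+Q\not\equiv 0\pmod q$. If the Legendre symbol $\left(\frac{P^2-4Q}{q}\right)$ equals $1$, then $$V_{q-1}(P+2k,\,k^2+Pk+Q)\equiv (k^2+Pk+Q)^{q-1}+1 \pmod{q^2},$$ $$V_{\frac{q-1}{2}}^2(P+2k,\,k^2+Pk+Q)\equiv \Bigl((k^2+Pk+Q)^{\frac{q-1}{2}}+1\Bigr)^2 \pmod{q^2}.$$
   Context: For integers $P,Q$, the Lucas sequence $V_n(P,Q)$ is defined by $V_0=2$, $V_1=P$, and $V_i=PV_{i-1}-QV_{i-2}$ for $i\ge 2$. -}

module Defs where

open import Data.Nat using (ℕ; zero; suc; _∸_)
open import Data.Nat.Primality using (Prime)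
open import Data.Integer using (ℤ; +_; _+_; _-_; _*_; _^_)
open import Data.Integer.Divisibility using (_∣_)
open import Data.Product using (_×_; ∃)
open import Relation.Nullary using (¬_)

V : ℕ → ℤ → ℤ → ℤ
V zero P Q = + 2
V (suc zero) P Q = P
V (suc (suc n)) P Q = P * V (suc n) P Q - Q * V n P Q

infix 4 _≡_[mod_]
_≡_[mod_] : ℤ → ℤ → ℤ → Set
a ≡ b [mod m ] = m ∣ (a - b)

LegendreIsOne : ℤ → ℕ → Set
LegendreIsOne a q = ¬ ((+ q) ∣ a) × ∃ λ (x : ℤ) → (x * x) ≡ a [mod (+ q) ]

-- Modulo q the discriminant D = P² − 4Q is a nonzero square x², so with A = P + x and
-- B = P − x one has 2ⁿVₙ ≡ Aⁿ + Bⁿ (mod q) (A/2 and B/2 are the roots of t² − Pt + Q).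
-- Fermat's little theorem then gives V_{q−1} ≡ 2 and Q^{q−1} ≡ 1, and V² − DU² = 4Qⁿ
-- forces q ∣ U_{q−1}.  Hence (V − Q^{q−1} − 1)(V + Q^{q−1} + 1) = DU² − (Q^{q−1} − 1)²
-- is divisible by q², while the second factor is ≡ 4 (mod q).  The squared version
-- follows from V_{2h} = V_h² − 2Qʰ, and the shift P ↦ P + 2k, Q ↦ k² + Pk + Q keeps D.

module Submission where

open import Defs
open import Data.Nat using (ℕ; _∸_; _/_) renaming (_*_ to _ℕ*_)
open import Data.Nat.Primality using (Prime)
open import Data.Integer using (ℤ; +_; _+_; _-_; _*_; _^_)
open import Data.Integer.Divisibility using (_∣_)
open import Relation.Nullary using (¬_)
open import Relation.Binary.PropositionalEquality using (_≢_)
open import Data.Product using (_×_)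

import Algebra.Properties.CommutativeSemiring.Binomial
import Algebra.Properties.Monoid.Mult
import Algebra.Properties.Monoid.Sum
import Algebra.Properties.Semiring.Exp
open import Data.Empty using (⊥-elim)
open import Data.Fin as Fin using (Fin; toℕ; inject₁; fromℕ)
open import Data.Fin.Properties using (toℕ-inject₁; toℕ<n; toℕ-fromℕ)
open import Data.Integer using (-_; -[1+_]; ∣_∣)
import Data.Integer.Divisibility.Signed as Signed
import Data.Integer.Properties as ℤ
open import Data.Integer.Tactic.RingSolver using (solve-∀)
open import Data.Nat as ℕ using (zero; suc; _<_; s≤s)
open import Data.Nat.Combinatorics using (_C_; nCn≡1; nCk+nC[k+1]≡[n+1]C[k+1]; nC1≡n)
import Data.Nat.Divisibility as ℕ
import Data.Nat.DivMod as ℕDM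
open import Data.Nat.Primality using (euclidsLemma; prime⇒nonZero; prime⇒nonTrivial; prime⇒irreducible)
import Data.Nat.Properties as ℕ
import Data.Nat.Tactic.RingSolver as ℕ-Solver
open import Data.Product using (_,_; proj₁)
open import Data.Sum using (_⊎_; inj₁; inj₂; [_,_]′)
open import Function using (_∘_; id)
open import Level using (0ℓ)
open import Relation.Binary.Bundles using (Setoid)
open import Relation.Binary.PropositionalEquality
  using (_≡_; refl; sym; trans; cong; cong₂; subst; module ≡-Reasoning)
import Relation.Binary.Reasoning.Setoid as SetoidReasoning

-- Congruences modulo an integer

-- `a ≡ b [mod m ]` unfolds to a divisibility of absolute values, from which
-- Agda cannot recover a and b; this wrapper keeps them visible to inference.
infix 4 _≈_⟨mod_⟩
record _≈_⟨mod_⟩ (a b m : ℤ) : Set where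
  constructor from-≡-mod
  field to-≡-mod : a ≡ b [mod m ]
open _≈_⟨mod_⟩ public

module _ {m : ℤ} where

  ∣m∣n⇒∣m+n : ∀ a b → m ∣ a → m ∣ b → m ∣ a + b
  ∣m∣n⇒∣m+n a b m∣a m∣b =
    Signed.∣⇒∣ᵤ {m} {a + b} (Signed.∣m∣n⇒∣m+n (Signed.∣ᵤ⇒∣ {m} {a} m∣a) (Signed.∣ᵤ⇒∣ {m} {b} m∣b))

  ∣m⇒∣-m : ∀ a → m ∣ a → m ∣ - a
  ∣m⇒∣-m a m∣a = Signed.∣⇒∣ᵤ {m} { - a} (Signed.∣m⇒∣-m (Signed.∣ᵤ⇒∣ {m} {a} m∣a))

  ∣m⇒∣m*n : ∀ a c → m ∣ a → m ∣ a * c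
  ∣m⇒∣m*n a c m∣a = Signed.∣⇒∣ᵤ {m} {a * c} (Signed.∣m⇒∣m*n c (Signed.∣ᵤ⇒∣ {m} {a} m∣a))

  ∣n⇒∣m*n : ∀ c a → m ∣ a → m ∣ c * a
  ∣n⇒∣m*n c a m∣a = Signed.∣⇒∣ᵤ {m} {c * a} (Signed.∣n⇒∣m*n c (Signed.∣ᵤ⇒∣ {m} {a} m∣a))

  ∣⇒≈0 : ∀ a → m ∣ a → a ≈ + 0 ⟨mod m ⟩
  ∣⇒≈0 a m∣a = from-≡-mod (subst (m ∣_) (sym (ℤ.+-identityʳ a)) m∣a)

  ≈0⇒∣ : ∀ {a} → a ≈ + 0 ⟨mod m ⟩ → m ∣ a
  ≈0⇒∣ {a} (from-≡-mod m∣a) = subst (m ∣_) (ℤ.+-identityʳ a) m∣a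

  ≡⇒≈ : ∀ {a b} → a ≡ b → a ≈ b ⟨mod m ⟩
  ≡⇒≈ {a} refl = from-≡-mod (subst (m ∣_) (sym (ℤ.+-inverseʳ a)) (ℕ._∣0 _))

  ≈-refl : ∀ {a} → a ≈ a ⟨mod m ⟩
  ≈-refl = ≡⇒≈ refl

  ≈-sym : ∀ {a b} → a ≈ b ⟨mod m ⟩ → b ≈ a ⟨mod m ⟩
  ≈-sym {a} {b} (from-≡-mod a≡b) = from-≡-mod (subst (m ∣_) (eq a b) (∣m⇒∣-m (a - b) a≡b))
    where eq : ∀ a b → - (a - b) ≡ b - a
          eq = solve-∀

  ≈-trans : ∀ {a b c} → a ≈ b ⟨mod m ⟩ → b ≈ c ⟨mod m ⟩ → a ≈ c ⟨mod m ⟩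
  ≈-trans {a} {b} {c} (from-≡-mod a≡b) (from-≡-mod b≡c) =
    from-≡-mod (subst (m ∣_) (eq a b c) (∣m∣n⇒∣m+n (a - b) (b - c) a≡b b≡c))
    where eq : ∀ a b c → (a - b) + (b - c) ≡ a - c
          eq = solve-∀

  +-cong : ∀ {a b c d} → a ≈ b ⟨mod m ⟩ → c ≈ d ⟨mod m ⟩ → a + c ≈ b + d ⟨mod m ⟩
  +-cong {a} {b} {c} {d} (from-≡-mod a≡b) (from-≡-mod c≡d) =
    from-≡-mod (subst (m ∣_) (eq a b c d) (∣m∣n⇒∣m+n (a - b) (c - d) a≡b c≡d))
    where eq : ∀ a b c d → (a - b) + (c - d) ≡ (a + c) - (b + d)
          eq = solve-∀

  +-congˡ : ∀ a {b c} → b ≈ c ⟨mod m ⟩ → a + b ≈ a + c ⟨mod m ⟩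
  +-congˡ a = +-cong (≈-refl {a})

  +-congʳ : ∀ a {b c} → b ≈ c ⟨mod m ⟩ → b + a ≈ c + a ⟨mod m ⟩
  +-congʳ a b≈c = +-cong b≈c (≈-refl {a})

  +-cancelʳ : ∀ {a b} c → a + c ≈ b + c ⟨mod m ⟩ → a ≈ b ⟨mod m ⟩
  +-cancelʳ {a} {b} c (from-≡-mod a+c≡b+c) = from-≡-mod (subst (m ∣_) (eq a b c) a+c≡b+c)
    where eq : ∀ a b c → (a + c) - (b + c) ≡ a - b
          eq = solve-∀

  -cong : ∀ {a b c d} → a ≈ b ⟨mod m ⟩ → c ≈ d ⟨mod m ⟩ → a - c ≈ b - d ⟨mod m ⟩
  -cong {a} {b} {c} {d} (from-≡-mod a≡b) (from-≡-mod c≡d) =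
    from-≡-mod (subst (m ∣_) (eq a b c d) (∣m∣n⇒∣m+n (a - b) (- (c - d)) a≡b (∣m⇒∣-m (c - d) c≡d)))
    where eq : ∀ a b c d → (a - b) + - (c - d) ≡ (a - c) - (b - d)
          eq = solve-∀

  *-cong : ∀ {a b c d} → a ≈ b ⟨mod m ⟩ → c ≈ d ⟨mod m ⟩ → a * c ≈ b * d ⟨mod m ⟩
  *-cong {a} {b} {c} {d} (from-≡-mod a≡b) (from-≡-mod c≡d) =
    from-≡-mod (subst (m ∣_) (eq a b c d)
      (∣m∣n⇒∣m+n ((a - b) * c) (b * (c - d)) (∣m⇒∣m*n (a - b) c a≡b) (∣n⇒∣m*n b (c - d) c≡d)))
    where eq : ∀ a b c d → (a - b) * c + b * (c - d) ≡ a * c - b * d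
          eq = solve-∀

  *-congˡ : ∀ a {b c} → b ≈ c ⟨mod m ⟩ → a * b ≈ a * c ⟨mod m ⟩
  *-congˡ a = *-cong (≈-refl {a})

  *-congʳ : ∀ a {b c} → b ≈ c ⟨mod m ⟩ → b * a ≈ c * a ⟨mod m ⟩
  *-congʳ a b≈c = *-cong b≈c (≈-refl {a})

≈-setoid : ℤ → Setoid 0ℓ 0ℓ
≈-setoid m = record
  { Carrier = ℤ
  ; _≈_ = _≈_⟨mod m ⟩
  ; isEquivalence = record { refl = ≈-refl ; sym = ≈-sym ; trans = ≈-trans }
  }

module ≈-Reasoning (m : ℤ) = SetoidReasoning (≈-setoid m)

-- Fermat's little theorem

module ℤ-Binomial = Algebra.Properties.CommutativeSemiring.Binomial ℤ.+-*-commutativeSemiring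
module ℤ-Exp = Algebra.Properties.Semiring.Exp ℤ.+-*-semiring
module ℤ-Mult = Algebra.Properties.Monoid.Mult ℤ.+-0-monoid
module ℤ-Sum = Algebra.Properties.Monoid.Sum ℤ.+-0-monoid

Exp^≡^ : ∀ x n → x ℤ-Exp.^ n ≡ x ^ n
Exp^≡^ x zero = refl
Exp^≡^ x (suc n) = cong (x *_) (Exp^≡^ x n)

×≡* : ∀ n x → n ℤ-Mult.× x ≡ + n * x
×≡* zero x = refl
×≡* (suc n) x = trans (cong (λ y → x + y) (×≡* n x)) (sym (ℤ.suc-* (+ n) x))

∣-sum : ∀ {m n} (f : Fin n → ℤ) → (∀ i → m ∣ f i) → m ∣ ℤ-Sum.sum f
∣-sum {m} {zero} f m∣f = ℕ._∣0 _
∣-sum {m} {suc n} f m∣f =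
  ∣m∣n⇒∣m+n {m} (f Fin.zero) (ℤ-Sum.sum (f ∘ Fin.suc)) (m∣f Fin.zero) (∣-sum {m} (f ∘ Fin.suc) (m∣f ∘ Fin.suc))

[k+1]*[n+1]C[k+1]≡[n+1]*nCk : ∀ n k → suc k ℕ.* (suc n C suc k) ≡ suc n ℕ.* (n C k)
[k+1]*[n+1]C[k+1]≡[n+1]*nCk zero zero = refl
[k+1]*[n+1]C[k+1]≡[n+1]*nCk zero (suc k) = ℕ.*-zeroʳ (2 ℕ.+ k)
[k+1]*[n+1]C[k+1]≡[n+1]*nCk (suc n) zero =
  trans (ℕ.*-identityˡ _) (trans (nC1≡n (2 ℕ.+ n)) (sym (ℕ.*-identityʳ _)))
[k+1]*[n+1]C[k+1]≡[n+1]*nCk (suc n) (suc k) = begin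
  (2 ℕ.+ k) ℕ.* (suc (suc n) C (2 ℕ.+ k))
    ≡⟨ cong ((2 ℕ.+ k) ℕ.*_) (nCk+nC[k+1]≡[n+1]C[k+1] (suc n) (suc k)) ⟨
  (2 ℕ.+ k) ℕ.* (a ℕ.+ c)
    ≡⟨ regroup k a c ⟩
  (1 ℕ.+ k) ℕ.* a ℕ.+ a ℕ.+ (2 ℕ.+ k) ℕ.* c
    ≡⟨ cong₂ (λ u v → u ℕ.+ a ℕ.+ v) ([k+1]*[n+1]C[k+1]≡[n+1]*nCk n k) ([k+1]*[n+1]C[k+1]≡[n+1]*nCk n (suc k)) ⟩
  (1 ℕ.+ n) ℕ.* (n C k) ℕ.+ a ℕ.+ (1 ℕ.+ n) ℕ.* (n C suc k)
    ≡⟨ regroup′ n a (n C k) (n C suc k) ⟩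
  a ℕ.+ (1 ℕ.+ n) ℕ.* ((n C k) ℕ.+ (n C suc k))
    ≡⟨ cong (λ b → a ℕ.+ (1 ℕ.+ n) ℕ.* b) (nCk+nC[k+1]≡[n+1]C[k+1] n k) ⟩
  (2 ℕ.+ n) ℕ.* a ∎
  where
  open ≡-Reasoning
  a = suc n C suc k
  c = suc n C (2 ℕ.+ k)
  regroup : ∀ k a c → (2 ℕ.+ k) ℕ.* (a ℕ.+ c) ≡ (1 ℕ.+ k) ℕ.* a ℕ.+ a ℕ.+ (2 ℕ.+ k) ℕ.* c
  regroup = ℕ-Solver.solve-∀
  regroup′ : ∀ n a b d → (1 ℕ.+ n) ℕ.* b ℕ.+ a ℕ.+ (1 ℕ.+ n) ℕ.* d ≡ a ℕ.+ (1 ℕ.+ n) ℕ.* (b ℕ.+ d)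
  regroup′ = ℕ-Solver.solve-∀

prime∣pC[k+1] : ∀ {n} → Prime (suc n) → ∀ {k} → k < n → suc n ℕ.∣ suc n C suc k
prime∣pC[k+1] {n} p-prime {k} k<n
  with euclidsLemma (suc k) _ p-prime
         (subst (suc n ℕ.∣_) (sym ([k+1]*[n+1]C[k+1]≡[n+1]*nCk n k)) (ℕ.m∣m*n (n C k)))
... | inj₁ p∣k+1 = ⊥-elim (ℕ.<⇒≱ (s≤s k<n) (ℕ.∣⇒≤ p∣k+1))
... | inj₂ p∣pC[k+1] = p∣pC[k+1]

binomialTerm≡ : ∀ x n (i : Fin (suc n)) → ℤ-Binomial.binomialTerm x (+ 1) n i ≡ + (n C toℕ i) * x ^ toℕ i
binomialTerm≡ x n i = begin
  (n C k) ℤ-Mult.× (x ℤ-Exp.^ k * (+ 1) ℤ-Exp.^ (n ∸ k)) ≡⟨ ×≡* (n C k) _ ⟩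
  + (n C k) * (x ℤ-Exp.^ k * (+ 1) ℤ-Exp.^ (n ∸ k))
    ≡⟨ cong (λ y → + (n C k) * y) (cong₂ _*_ (Exp^≡^ x k) (trans (Exp^≡^ (+ 1) (n ∸ k)) (ℤ.^-zeroˡ (n ∸ k)))) ⟩
  + (n C k) * (x ^ k * + 1)                           ≡⟨ cong (λ y → + (n C k) * y) (ℤ.*-identityʳ (x ^ k)) ⟩
  + (n C k) * x ^ k                                   ∎
  where
  open ≡-Reasoning
  k = toℕ i

binomialTerm-last : ∀ x n → ℤ-Binomial.binomialTerm x (+ 1) n (fromℕ n) ≡ x ^ n
binomialTerm-last x n = begin
  ℤ-Binomial.binomialTerm x (+ 1) n (fromℕ n)  ≡⟨ binomialTerm≡ x n (fromℕ n) ⟩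
  + (n C toℕ (fromℕ n)) * x ^ toℕ (fromℕ n)    ≡⟨ cong (λ k → + (n C k) * x ^ k) (toℕ-fromℕ n) ⟩
  + (n C n) * x ^ n                            ≡⟨ cong (λ c → + c * x ^ n) (nCn≡1 n) ⟩
  + 1 * x ^ n                                  ≡⟨ ℤ.*-identityˡ (x ^ n) ⟩
  x ^ n                                        ∎
  where open ≡-Reasoning

prime∣*⇒∣⊎∣ : ∀ {p} → Prime p → ∀ a b → + p ∣ a * b → (+ p ∣ a) ⊎ (+ p ∣ b)
prime∣*⇒∣⊎∣ {p} p-prime a b = euclidsLemma ∣ a ∣ ∣ b ∣ p-prime ∘ subst (p ℕ.∣_) (ℤ.abs-* a b)

*∣*⇒*∣* : ∀ {p q a b} → + p ∣ a → + q ∣ b → + (p ℕ* q) ∣ a * b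
*∣*⇒*∣* {a = a} {b} p∣a q∣b = subst (_ ℕ.∣_) (sym (ℤ.abs-* a b)) (ℕ.*-pres-∣ p∣a q∣b)

prime∣*∧∤⇒∣ : ∀ {p a b} → Prime p → p ℕ.∣ a ℕ* b → ¬ p ℕ.∣ b → p ℕ.∣ a
prime∣*∧∤⇒∣ {a = a} {b} p-prime p∣ab p∤b with euclidsLemma a b p-prime p∣ab
... | inj₁ p∣a = p∣a
... | inj₂ p∣b = ⊥-elim (p∤b p∣b)

prime²∣*⇒∣ : ∀ {p a b} → Prime p → p ℕ* p ℕ.∣ a ℕ* b → ¬ p ℕ.∣ b → p ℕ* p ℕ.∣ a
prime²∣*⇒∣ {p} {a} {b} p-prime p²∣ab p∤b
  with prime∣*∧∤⇒∣ {a = a} p-prime (ℕ.∣-trans (ℕ.m∣m*n p) p²∣ab) p∤b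
... | ℕ.divides-refl c = ℕ.*-monoˡ-∣ p (prime∣*∧∤⇒∣ {a = c} p-prime p∣cb p∤b)
  where
  instance _ = prime⇒nonZero p-prime
  regroup : ∀ c p b → c ℕ* p ℕ* b ≡ p ℕ* (c ℕ* b)
  regroup = ℕ-Solver.solve-∀
  p∣cb : p ℕ.∣ c ℕ* b
  p∣cb = ℕ.*-cancelˡ-∣ p (subst (p ℕ* p ℕ.∣_) (regroup c p b) p²∣ab)

2∣n⊎2∣1+n : ∀ n → 2 ℕ.∣ n ⊎ 2 ℕ.∣ suc n
2∣n⊎2∣1+n zero = inj₁ (2 ℕ.∣0)
2∣n⊎2∣1+n (suc n) with 2∣n⊎2∣1+n n
... | inj₁ 2∣n = inj₂ (ℕ.∣m∣n⇒∣m+n ℕ.∣-refl 2∣n)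
... | inj₂ 2∣1+n = inj₁ 2∣1+n

[n/2]+[n/2]≡n : ∀ {n} → 2 ℕ.∣ n → n / 2 ℕ.+ n / 2 ≡ n
[n/2]+[n/2]≡n {n} 2∣n = trans (cong (n / 2 ℕ.+_) (sym (ℕ.+-identityʳ (n / 2)))) (ℕDM.m*[n/m]≡n 2∣n)

module _ {q : ℕ} (q-prime : Prime q) (q≢2 : q ≢ 2) where

  odd-prime-∤2 : ¬ + q ∣ + 2
  odd-prime-∤2 q∣2 = q≢2 (ℕ.≤-antisym (ℕ.∣⇒≤ q∣2) (ℕ.nonTrivial⇒n>1 q {{prime⇒nonTrivial q-prime}}))

  odd-prime-∤4 : ¬ + q ∣ + 4
  odd-prime-∤4 q∣4 with prime∣*⇒∣⊎∣ q-prime (+ 2) (+ 2) q∣4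
  ... | inj₁ q∣2 = odd-prime-∤2 q∣2
  ... | inj₂ q∣2 = odd-prime-∤2 q∣2

  odd-prime-∤4* : ∀ {a} → ¬ + q ∣ a → ¬ + q ∣ + 4 * a
  odd-prime-∤4* {a} q∤a q∣4a with prime∣*⇒∣⊎∣ q-prime (+ 4) a q∣4a
  ... | inj₁ q∣4 = odd-prime-∤4 q∣4
  ... | inj₂ q∣a = q∤a q∣a

  odd-prime-2∣pred : 2 ℕ.∣ q ∸ 1
  odd-prime-2∣pred with 2∣n⊎2∣1+n (q ∸ 1)
  ... | inj₁ 2∣q-1 = 2∣q-1
  ... | inj₂ 2∣q with prime⇒irreducible q-prime (subst (2 ℕ.∣_) (ℕ.suc-pred q {{prime⇒nonZero q-prime}}) 2∣q)
  ...   | inj₂ 2≡q = ⊥-elim (q≢2 (sym 2≡q))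

module _ {n : ℕ} (p-prime : Prime (suc n)) where

  private
    p : ℕ
    p = suc n

  frobenius : ∀ x → (x + + 1) ^ p ≈ x ^ p + + 1 ⟨mod + p ⟩
  frobenius x = begin
    (x + + 1) ^ p                       ≡⟨ Exp^≡^ (x + + 1) p ⟨
    (x + + 1) ℤ-Exp.^ p                 ≡⟨ ℤ-Binomial.theorem p x (+ 1) ⟩
    t Fin.zero + ℤ-Sum.sum (t ∘ Fin.suc)     ≡⟨ cong₂ _+_ (binomialTerm≡ x p Fin.zero) (ℤ-Sum.sum-init-last (t ∘ Fin.suc)) ⟩
    + 1 + (middle + t (fromℕ p))         ≈⟨ +-congˡ (+ 1) (+-cong (∣⇒≈0 middle middle-divisible) (≡⇒≈ (binomialTerm-last x p))) ⟩
    + 1 + (+ 0 + x ^ p)                 ≡⟨ cong (_+_ (+ 1)) (ℤ.+-identityˡ (x ^ p)) ⟩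
    + 1 + x ^ p                         ≡⟨ ℤ.+-comm (+ 1) (x ^ p) ⟩
    x ^ p + + 1                         ∎
    where
    open ≈-Reasoning (+ p)
    t = ℤ-Binomial.binomialTerm x (+ 1) p
    middle = ℤ-Sum.sum (λ i → t (Fin.suc (inject₁ i)))
    middle-divisible : + p ∣ middle
    middle-divisible = ∣-sum {+ p} (λ i → t (Fin.suc (inject₁ i))) middle-term-divisible
      where
      middle-term-divisible : ∀ i → + p ∣ t (Fin.suc (inject₁ i))
      middle-term-divisible i = subst (+ p ∣_) (sym (binomialTerm≡ x p (Fin.suc (inject₁ i))))
        (∣m⇒∣m*n {+ p} (+ (p C suc j)) (x ^ suc j) (prime∣pC[k+1] p-prime j<n))
        where
        j = toℕ (inject₁ i)
        j<n : j ℕ.< n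
        j<n = subst (ℕ._< n) (sym (toℕ-inject₁ i)) (toℕ<n i)

  fermat-suc : ∀ y → y ^ p ≈ y ⟨mod + p ⟩ → (y + + 1) ^ p ≈ y + + 1 ⟨mod + p ⟩
  fermat-suc y yᵖ≈y = ≈-trans (frobenius y) (+-congʳ (+ 1) yᵖ≈y)

  fermat-pred : ∀ y → (y + + 1) ^ p ≈ y + + 1 ⟨mod + p ⟩ → y ^ p ≈ y ⟨mod + p ⟩
  fermat-pred y h = +-cancelʳ (+ 1) (≈-trans (≈-sym (frobenius y)) h)

  fermat : ∀ x → x ^ p ≈ x ⟨mod + p ⟩
  fermat (+ zero) = ≡⇒≈ (ℤ.*-zeroˡ ((+ 0) ^ n))
  fermat (+ suc m) = subst (λ y → y ^ p ≈ y ⟨mod + p ⟩) (cong (λ k → + k) (ℕ.+-comm m 1))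
    (fermat-suc (+ m) (fermat (+ m)))
  fermat -[1+ zero ] = fermat-pred -[1+ 0 ] (fermat (+ 0))
  fermat -[1+ suc m ] = fermat-pred -[1+ suc m ] (fermat -[1+ m ])

  fermat-little : ∀ {x} → ¬ + p ∣ x → x ^ n ≈ + 1 ⟨mod + p ⟩
  fermat-little {x} p∤x =
    from-≡-mod ([ ⊥-elim ∘ p∤x , id ]′ (prime∣*⇒∣⊎∣ p-prime x (x ^ n - + 1) p∣x[xⁿ-1]))
    where
    factor : ∀ x y → x * y - x ≡ x * (y - + 1)
    factor = solve-∀
    p∣x[xⁿ-1] : + p ∣ x * (x ^ n - + 1)
    p∣x[xⁿ-1] = subst (+ p ∣_) (factor x (x ^ n)) (to-≡-mod (fermat x))

-- Lucas sequences

U : ℕ → ℤ → ℤ → ℤ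
U zero P Q = + 0
U (suc zero) P Q = + 1
U (suc (suc n)) P Q = P * U (suc n) P Q - Q * U n P Q

module Lucas (P Q : ℤ) where

  D : ℤ
  D = P * P - + 4 * Q

  Recurrent : (ℕ → ℤ) → Set
  Recurrent f = ∀ n → f (2 ℕ.+ n) ≡ P * f (1 ℕ.+ n) - Q * f n

  U-recurrent : Recurrent (λ n → U n P Q)
  U-recurrent n = refl

  V-recurrent : Recurrent (λ n → V n P Q)
  V-recurrent n = refl

  suc-recurrent : ∀ {f} → Recurrent f → Recurrent (f ∘ suc)
  suc-recurrent rec n = rec (suc n)

  shift-recurrent : ∀ {f} m → Recurrent f → Recurrent (λ n → f (n ℕ.+ m))
  shift-recurrent m rec n = rec (n ℕ.+ m)

  *-recurrent : ∀ {f} c → Recurrent f → Recurrent (λ n → c * f n)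
  *-recurrent {f} c rec n = begin
    c * f (2 ℕ.+ n)                          ≡⟨ cong (c *_) (rec n) ⟩
    c * (P * f (1 ℕ.+ n) - Q * f n)          ≡⟨ eq P Q c (f (1 ℕ.+ n)) (f n) ⟩
    P * (c * f (1 ℕ.+ n)) - Q * (c * f n)    ∎
    where
    open ≡-Reasoning
    eq : ∀ P Q c a b → c * (P * a - Q * b) ≡ P * (c * a) - Q * (c * b)
    eq = solve-∀

  +-recurrent : ∀ {f g} → Recurrent f → Recurrent g → Recurrent (λ n → f n + g n)
  +-recurrent {f} {g} rec-f rec-g n = begin
    f (2 ℕ.+ n) + g (2 ℕ.+ n)                       ≡⟨ cong₂ _+_ (rec-f n) (rec-g n) ⟩
    (P * f (1 ℕ.+ n) - Q * f n) + (P * g (1 ℕ.+ n) - Q * g n) ≡⟨ eq P Q (f (1 ℕ.+ n)) (f n) (g (1 ℕ.+ n)) (g n) ⟩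
    P * (f (1 ℕ.+ n) + g (1 ℕ.+ n)) - Q * (f n + g n) ∎
    where
    open ≡-Reasoning
    eq : ∀ P Q a b c d → (P * a - Q * b) + (P * c - Q * d) ≡ P * (a + c) - Q * (b + d)
    eq = solve-∀

  -‿recurrent : ∀ {f g} → Recurrent f → Recurrent g → Recurrent (λ n → f n - g n)
  -‿recurrent {f} {g} rec-f rec-g n = begin
    f (2 ℕ.+ n) - g (2 ℕ.+ n)                       ≡⟨ cong₂ _-_ (rec-f n) (rec-g n) ⟩
    (P * f (1 ℕ.+ n) - Q * f n) - (P * g (1 ℕ.+ n) - Q * g n) ≡⟨ eq P Q (f (1 ℕ.+ n)) (f n) (g (1 ℕ.+ n)) (g n) ⟩
    P * (f (1 ℕ.+ n) - g (1 ℕ.+ n)) - Q * (f n - g n) ∎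
    where
    open ≡-Reasoning
    eq : ∀ P Q a b c d → (P * a - Q * b) - (P * c - Q * d) ≡ P * (a - c) - Q * (b - d)
    eq = solve-∀

  recurrent-unique : ∀ {f g} → Recurrent f → Recurrent g → f 0 ≡ g 0 → f 1 ≡ g 1 → ∀ n → f n ≡ g n
  recurrent-unique {f} {g} rec-f rec-g f₀≡g₀ f₁≡g₁ n = proj₁ (agree n)
    where
    agree : ∀ n → f n ≡ g n × f (suc n) ≡ g (suc n)
    agree zero = f₀≡g₀ , f₁≡g₁
    agree (suc n) with agree n
    ... | fₙ≡gₙ , fₙ₊₁≡gₙ₊₁ =
      fₙ₊₁≡gₙ₊₁ , trans (rec-f n) (trans (cong₂ (λ a b → P * a - Q * b) fₙ₊₁≡gₙ₊₁ fₙ≡gₙ) (sym (rec-g n)))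

  V≡2U[n+1]-PU : ∀ n → V n P Q ≡ + 2 * U (suc n) P Q - P * U n P Q
  V≡2U[n+1]-PU = recurrent-unique V-recurrent
    (-‿recurrent (*-recurrent (+ 2) (suc-recurrent U-recurrent)) (*-recurrent P U-recurrent))
    (base₀ P) (base₁ P Q)
    where
    base₀ : ∀ P → + 2 ≡ + 2 * + 1 - P * + 0
    base₀ = solve-∀
    base₁ : ∀ P Q → P ≡ + 2 * (P * + 1 - Q * + 0) - P * + 1
    base₁ = solve-∀

  U-norm : ∀ n → U (suc n) P Q * U (suc n) P Q - P * U (suc n) P Q * U n P Q + Q * (U n P Q * U n P Q) ≡ Q ^ n
  U-norm zero = base P Q
    where
    base : ∀ P Q → + 1 * + 1 - P * + 1 * + 0 + Q * (+ 0 * + 0) ≡ + 1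
    base = solve-∀
  U-norm (suc n) = trans (step P Q (U n P Q) (U (suc n) P Q)) (cong (Q *_) (U-norm n))
    where
    step : ∀ P Q u₀ u₁ → (P * u₁ - Q * u₀) * (P * u₁ - Q * u₀) - P * (P * u₁ - Q * u₀) * u₁ + Q * (u₁ * u₁)
                       ≡ Q * (u₁ * u₁ - P * u₁ * u₀ + Q * (u₀ * u₀))
    step = solve-∀

  V²≡DU²+4Qⁿ : ∀ n → V n P Q * V n P Q ≡ D * (U n P Q * U n P Q) + + 4 * Q ^ n
  V²≡DU²+4Qⁿ n = begin
    V n P Q * V n P Q                       ≡⟨ cong₂ _*_ (V≡2U[n+1]-PU n) (V≡2U[n+1]-PU n) ⟩
    (+ 2 * u₁ - P * u₀) * (+ 2 * u₁ - P * u₀) ≡⟨ expand P Q u₀ u₁ ⟩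
    D * (u₀ * u₀) + + 4 * (u₁ * u₁ - P * u₁ * u₀ + Q * (u₀ * u₀)) ≡⟨ cong (λ y → D * (u₀ * u₀) + + 4 * y) (U-norm n) ⟩
    D * (u₀ * u₀) + + 4 * Q ^ n             ∎
    where
    open ≡-Reasoning
    u₀ = U n P Q
    u₁ = U (suc n) P Q
    expand : ∀ P Q u₀ u₁ → (+ 2 * u₁ - P * u₀) * (+ 2 * u₁ - P * u₀)
                         ≡ (P * P - + 4 * Q) * (u₀ * u₀) + + 4 * (u₁ * u₁ - P * u₁ * u₀ + Q * (u₀ * u₀))
    expand = solve-∀

  2V[n+1]≡PV+DU : ∀ n → + 2 * V (suc n) P Q ≡ P * V n P Q + D * U n P Q
  2V[n+1]≡PV+DU = recurrent-unique (*-recurrent (+ 2) (suc-recurrent V-recurrent))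
    (+-recurrent (*-recurrent P V-recurrent) (*-recurrent D U-recurrent))
    (base₀ P Q) (base₁ P Q)
    where
    base₀ : ∀ P Q → + 2 * P ≡ P * + 2 + (P * P - + 4 * Q) * + 0
    base₀ = solve-∀
    base₁ : ∀ P Q → + 2 * (P * P - Q * + 2) ≡ P * P + (P * P - + 4 * Q) * + 1
    base₁ = solve-∀

  2V[n+m]≡VV+DUU : ∀ m n → + 2 * V (n ℕ.+ m) P Q ≡ V m P Q * V n P Q + D * U m P Q * U n P Q
  2V[n+m]≡VV+DUU m = recurrent-unique (*-recurrent (+ 2) (shift-recurrent m V-recurrent))
    (+-recurrent (*-recurrent (V m P Q) V-recurrent) (*-recurrent (D * U m P Q) U-recurrent))
    (base₀ D (V m P Q) (U m P Q)) (trans (2V[n+1]≡PV+DU m) (base₁ P D (V m P Q) (U m P Q)))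
    where
    base₀ : ∀ D v u → + 2 * v ≡ v * + 2 + D * u * + 0
    base₀ = solve-∀
    base₁ : ∀ P D v u → P * v + D * u ≡ v * P + D * u * + 1
    base₁ = solve-∀

  V[n+n]≡V²-2Qⁿ : ∀ n → V (n ℕ.+ n) P Q ≡ V n P Q * V n P Q - + 2 * Q ^ n
  V[n+n]≡V²-2Qⁿ n = ℤ.*-cancelˡ-≡ (+ 2) _ _ (begin
    + 2 * V (n ℕ.+ n) P Q              ≡⟨ 2V[n+m]≡VV+DUU n n ⟩
    v * v + D * u * u                  ≡⟨ cong (λ y → y + D * u * u) (V²≡DU²+4Qⁿ n) ⟩
    D * (u * u) + + 4 * Q ^ n + D * u * u ≡⟨ regroup D u (Q ^ n) ⟩
    + 2 * ((D * (u * u) + + 4 * Q ^ n) - + 2 * Q ^ n) ≡⟨ cong (λ y → + 2 * (y - + 2 * Q ^ n)) (V²≡DU²+4Qⁿ n) ⟨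
    + 2 * (v * v - + 2 * Q ^ n)         ∎)
    where
    open ≡-Reasoning
    regroup : ∀ D u w → D * (u * u) + + 4 * w + D * u * u ≡ + 2 * ((D * (u * u) + + 4 * w) - + 2 * w)
    regroup = solve-∀
    v = V n P Q
    u = U n P Q

  binet : ∀ {m x} → x * x ≈ D ⟨mod m ⟩ → ∀ n → (+ 2) ^ n * V n P Q ≈ (P + x) ^ n + (P - x) ^ n ⟨mod m ⟩
  binet {m} {x} x²≈D n = proj₁ (agree n)
    where
    open ≈-Reasoning m
    L W : ℕ → ℤ
    L n = (+ 2) ^ n * V n P Q
    W n = (P + x) ^ n + (P - x) ^ n
    D-x²≈0 : D - x * x ≈ + 0 ⟨mod m ⟩
    D-x²≈0 = ∣⇒≈0 (D - x * x) (to-≡-mod (≈-sym x²≈D))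
    L-step : ∀ P Q t v₀ v₁ → (+ 2 * (+ 2 * t)) * (P * v₁ - Q * v₀) ≡ (+ 2 * P) * ((+ 2 * t) * v₁) - (+ 4 * Q) * (t * v₀)
    L-step = solve-∀
    W-step : ∀ P Q x a b → (+ 2 * P) * ((P + x) * a + (P - x) * b) - (+ 4 * Q) * (a + b)
                       ≡ ((P + x) * ((P + x) * a) + (P - x) * ((P - x) * b)) + (a + b) * ((P * P - + 4 * Q) - x * x)
    W-step = solve-∀
    W₁ : ∀ P x → + 2 * P ≡ (P + x) * + 1 + (P - x) * + 1
    W₁ = solve-∀
    step : ∀ n → L n ≈ W n ⟨mod m ⟩ → L (suc n) ≈ W (suc n) ⟨mod m ⟩ → L (2 ℕ.+ n) ≈ W (2 ℕ.+ n) ⟨mod m ⟩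
    step n Lₙ≈Wₙ Lₙ₊₁≈Wₙ₊₁ = begin
      L (2 ℕ.+ n)                                     ≡⟨ L-step P Q ((+ 2) ^ n) (V n P Q) (V (suc n) P Q) ⟩
      (+ 2 * P) * L (suc n) - (+ 4 * Q) * L n         ≈⟨ -cong (*-congˡ (+ 2 * P) Lₙ₊₁≈Wₙ₊₁) (*-congˡ (+ 4 * Q) Lₙ≈Wₙ) ⟩
      (+ 2 * P) * W (suc n) - (+ 4 * Q) * W n         ≡⟨ W-step P Q x ((P + x) ^ n) ((P - x) ^ n) ⟩
      W (2 ℕ.+ n) + W n * (D - x * x)                 ≈⟨ +-congˡ (W (2 ℕ.+ n)) (*-congˡ (W n) D-x²≈0) ⟩
      W (2 ℕ.+ n) + W n * + 0                         ≡⟨ cong (_+_ (W (2 ℕ.+ n))) (ℤ.*-zeroʳ (W n)) ⟩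
      W (2 ℕ.+ n) + + 0                               ≡⟨ ℤ.+-identityʳ (W (2 ℕ.+ n)) ⟩
      W (2 ℕ.+ n)                                     ∎
    agree : ∀ n → L n ≈ W n ⟨mod m ⟩ × L (suc n) ≈ W (suc n) ⟨mod m ⟩
    agree zero = ≈-refl , ≡⇒≈ (W₁ P x)
    agree (suc n) with agree n
    ... | Lₙ≈Wₙ , Lₙ₊₁≈Wₙ₊₁ = Lₙ₊₁≈Wₙ₊₁ , step n Lₙ≈Wₙ Lₙ₊₁≈Wₙ₊₁

  V[h+h]≈Q^[h+h]+1⇒V²≈[Qʰ+1]² : ∀ {m} h → V (h ℕ.+ h) P Q ≈ Q ^ (h ℕ.+ h) + + 1 ⟨mod m ⟩ →
                                V h P Q ^ 2 ≈ (Q ^ h + + 1) ^ 2 ⟨mod m ⟩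
  V[h+h]≈Q^[h+h]+1⇒V²≈[Qʰ+1]² {m} h V₂ₕ≈Q²ʰ+1 = begin
    V h P Q ^ 2                          ≡⟨ square (V h P Q) ⟩
    V h P Q * V h P Q                    ≡⟨ sub-add (V h P Q * V h P Q) (+ 2 * Q ^ h) ⟨
    (V h P Q * V h P Q - + 2 * Q ^ h) + + 2 * Q ^ h ≡⟨ cong (λ y → y + + 2 * Q ^ h) (V[n+n]≡V²-2Qⁿ h) ⟨
    V (h ℕ.+ h) P Q + + 2 * Q ^ h         ≈⟨ +-congʳ (+ 2 * Q ^ h) V₂ₕ≈Q²ʰ+1 ⟩
    Q ^ (h ℕ.+ h) + + 1 + + 2 * Q ^ h    ≡⟨ cong (λ y → y + + 1 + + 2 * Q ^ h) (ℤ.^-distribˡ-+-* Q h h) ⟩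
    Q ^ h * Q ^ h + + 1 + + 2 * Q ^ h    ≡⟨ complete-square (Q ^ h) ⟩
    (Q ^ h + + 1) * (Q ^ h + + 1)        ≡⟨ square (Q ^ h + + 1) ⟨
    (Q ^ h + + 1) ^ 2                    ∎
    where
    open ≈-Reasoning m
    square : ∀ a → a ^ 2 ≡ a * a
    square a = cong (a *_) (ℤ.*-identityʳ a)
    sub-add : ∀ a b → (a - b) + b ≡ a
    sub-add = solve-∀
    complete-square : ∀ w → w * w + + 1 + + 2 * w ≡ (w + + 1) * (w + + 1)
    complete-square = solve-∀

-- V_{q-1} modulo q²

module _ {n : ℕ} (q-prime : Prime (suc n)) (q≢2 : suc n ≢ 2) (P Q : ℤ) (q∤Q : ¬ + suc n ∣ Q) where

  open Lucas P Q

  private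
    q : ℕ
    q = suc n

  V[q-1]≈2 : ∀ {x} → x * x ≈ D ⟨mod + q ⟩ → V n P Q ≈ + 2 ⟨mod + q ⟩
  V[q-1]≈2 {x} x²≈D = begin
    V n P Q                             ≡⟨ ℤ.*-identityˡ (V n P Q) ⟨
    + 1 * V n P Q                       ≈⟨ *-congʳ (V n P Q) (≈-sym (fermat-little q-prime {+ 2} (odd-prime-∤2 q-prime q≢2))) ⟩
    (+ 2) ^ n * V n P Q                 ≈⟨ binet x²≈D n ⟩
    (P + x) ^ n + (P - x) ^ n           ≈⟨ +-cong (fermat-little q-prime {P + x} q∤A) (fermat-little q-prime {P - x} q∤B) ⟩
    + 2                                 ∎
    where
    open ≈-Reasoning (+ q)
    difference-of-squares : ∀ P x → (P + x) * (P - x) ≡ P * P - x * x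
    difference-of-squares = solve-∀
    cancel : ∀ P Q → P * P - (P * P - + 4 * Q) ≡ + 4 * Q
    cancel = solve-∀
    AB≈4Q : (P + x) * (P - x) ≈ + 4 * Q ⟨mod + q ⟩
    AB≈4Q = begin
      (P + x) * (P - x)         ≡⟨ difference-of-squares P x ⟩
      P * P - x * x             ≈⟨ -cong (≈-refl {a = P * P}) x²≈D ⟩
      P * P - (P * P - + 4 * Q) ≡⟨ cancel P Q ⟩
      + 4 * Q                   ∎
    q∤AB : ¬ + q ∣ (P + x) * (P - x)
    q∤AB q∣AB = odd-prime-∤4* q-prime q≢2 {Q} q∤Q (≈0⇒∣ (≈-trans (≈-sym AB≈4Q) (∣⇒≈0 ((P + x) * (P - x)) q∣AB)))
    q∤A : ¬ + q ∣ P + x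
    q∤A q∣A = q∤AB (∣m⇒∣m*n {+ q} (P + x) (P - x) q∣A)
    q∤B : ¬ + q ∣ P - x
    q∤B q∣B = q∤AB (∣n⇒∣m*n {+ q} (P + x) (P - x) q∣B)

  D*U²≈0 : V n P Q ≈ + 2 ⟨mod + q ⟩ → D * (U n P Q * U n P Q) ≈ + 0 ⟨mod + q ⟩
  D*U²≈0 Vₙ≈2 = begin
    D * (U n P Q * U n P Q)                    ≡⟨ add-sub (D * (U n P Q * U n P Q)) (+ 4 * Q ^ n) ⟨
    D * (U n P Q * U n P Q) + + 4 * Q ^ n - + 4 * Q ^ n ≡⟨ cong (_- + 4 * Q ^ n) (V²≡DU²+4Qⁿ n) ⟨
    V n P Q * V n P Q - + 4 * Q ^ n            ≈⟨ -cong (*-cong Vₙ≈2 Vₙ≈2) (*-congˡ (+ 4) (fermat-little q-prime {Q} q∤Q)) ⟩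
    + 2 * + 2 - + 4 * + 1                      ≡⟨⟩
    + 0                                        ∎
    where
    open ≈-Reasoning (+ q)
    add-sub : ∀ a b → a + b - b ≡ a
    add-sub = solve-∀

  q∣U[q-1] : ¬ + q ∣ D → V n P Q ≈ + 2 ⟨mod + q ⟩ → + q ∣ U n P Q
  q∣U[q-1] q∤D Vₙ≈2 = [ ⊥-elim ∘ q∤D , [ id , id ]′ ∘ prime∣*⇒∣⊎∣ q-prime (U n P Q) (U n P Q) ]′
    (prime∣*⇒∣⊎∣ q-prime D (U n P Q * U n P Q) (≈0⇒∣ (D*U²≈0 Vₙ≈2)))

  V[q-1]≈Q^[q-1]+1 : LegendreIsOne D q → V n P Q ≈ Q ^ n + + 1 ⟨mod + (q ℕ* q) ⟩
  V[q-1]≈Q^[q-1]+1 (q∤D , x , x²≡D) =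
    from-≡-mod (prime²∣*⇒∣ {a = ∣ a ∣} {∣ b ∣} q-prime (subst (q ℕ* q ℕ.∣_) (ℤ.abs-* a b) q²∣ab) q∤b)
    where
    v u w a b : ℤ
    v = V n P Q
    u = U n P Q
    w = Q ^ n
    a = v - (w + + 1)
    b = v + w + + 1
    v≈2 : v ≈ + 2 ⟨mod + q ⟩
    v≈2 = V[q-1]≈2 {x} (from-≡-mod x²≡D)
    w≈1 : w ≈ + 1 ⟨mod + q ⟩
    w≈1 = fermat-little q-prime {Q} q∤Q
    factor : a * b ≡ D * (u * u) - (w - + 1) * (w - + 1)
    factor = begin
      a * b                                 ≡⟨ expand v w ⟩
      v * v - (w + + 1) * (w + + 1)         ≡⟨ cong (_- (w + + 1) * (w + + 1)) (V²≡DU²+4Qⁿ n) ⟩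
      D * (u * u) + + 4 * w - (w + + 1) * (w + + 1) ≡⟨ regroup (D * (u * u)) w ⟩
      D * (u * u) - (w - + 1) * (w - + 1)   ∎
      where
      open ≡-Reasoning
      expand : ∀ v w → (v - (w + + 1)) * (v + w + + 1) ≡ v * v - (w + + 1) * (w + + 1)
      expand = solve-∀
      regroup : ∀ d w → d + + 4 * w - (w + + 1) * (w + + 1) ≡ d - (w - + 1) * (w - + 1)
      regroup = solve-∀
    q∣u : + q ∣ u
    q∣u = q∣U[q-1] q∤D v≈2
    DU²≈[w-1]² : D * (u * u) ≈ (w - + 1) * (w - + 1) ⟨mod + (q ℕ* q) ⟩
    DU²≈[w-1]² = ≈-trans
      (∣⇒≈0 (D * (u * u)) (∣n⇒∣m*n {+ (q ℕ* q)} D (u * u) (*∣*⇒*∣* {q} {q} {u} {u} q∣u q∣u)))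
      (≈-sym (∣⇒≈0 ((w - + 1) * (w - + 1)) (*∣*⇒*∣* {q} {q} {w - + 1} {w - + 1} (to-≡-mod w≈1) (to-≡-mod w≈1))))
    q²∣ab : + (q ℕ* q) ∣ a * b
    q²∣ab = subst (+ (q ℕ* q) ∣_) (sym factor) (to-≡-mod DU²≈[w-1]²)
    q∤b : ¬ + q ∣ b
    q∤b q∣b = odd-prime-∤4 q-prime q≢2 (≈0⇒∣ (≈-trans (≈-sym (+-congʳ (+ 1) (+-cong v≈2 w≈1))) (∣⇒≈0 b q∣b)))

corollary2 : (q : ℕ) → Prime q → q ≢ 2 → (k P Q : ℤ) →
    ¬ ((k * k + P * k + Q) ≡ + 0 [mod + q ]) →
    LegendreIsOne (P * P - + 4 * Q) q →
    (V (q ∸ 1) (P + + 2 * k) (k * k + P * k + Q)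
       ≡ (k * k + P * k + Q) ^ (q ∸ 1) + + 1 [mod + (q ℕ* q) ])
    × (V ((q ∸ 1) / 2) (P + + 2 * k) (k * k + P * k + Q) ^ 2
       ≡ ((k * k + P * k + Q) ^ ((q ∸ 1) / 2) + + 1) ^ 2 [mod + (q ℕ* q) ])
corollary2 zero 0-prime = ⊥-elim (ℕ.≢-nonZero⁻¹ 0 {{prime⇒nonZero 0-prime}} refl)
corollary2 q@(suc n) q-prime q≢2 k P Q q∤Q′ legendre = to-≡-mod V≈Q′ⁿ+1 , to-≡-mod V²≈[Q′ʰ+1]²
  where
  P′ Q′ : ℤ
  P′ = P + + 2 * k
  Q′ = k * k + P * k + Q
  same-discriminant : ∀ k P Q → (P + + 2 * k) * (P + + 2 * k) - + 4 * (k * k + P * k + Q) ≡ P * P - + 4 * Q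
  same-discriminant = solve-∀
  V≈Q′ⁿ+1 : V n P′ Q′ ≈ Q′ ^ n + + 1 ⟨mod + (q ℕ* q) ⟩
  V≈Q′ⁿ+1 = V[q-1]≈Q^[q-1]+1 q-prime q≢2 P′ Q′ (q∤Q′ ∘ to-≡-mod ∘ ∣⇒≈0 {+ q} Q′)
    (subst (λ d → LegendreIsOne d q) (sym (same-discriminant k P Q)) legendre)
  n≡h+h : n ≡ n / 2 ℕ.+ n / 2
  n≡h+h = sym ([n/2]+[n/2]≡n (odd-prime-2∣pred q-prime q≢2))
  V²≈[Q′ʰ+1]² : V (n / 2) P′ Q′ ^ 2 ≈ (Q′ ^ (n / 2) + + 1) ^ 2 ⟨mod + (q ℕ* q) ⟩
  V²≈[Q′ʰ+1]² = Lucas.V[h+h]≈Q^[h+h]+1⇒V²≈[Qʰ+1]² P′ Q′ (n / 2)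
    (subst (λ m → V m P′ Q′ ≈ Q′ ^ m + + 1 ⟨mod + (q ℕ* q) ⟩) n≡h+h V≈Q′ⁿ+1)
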